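{- Let $q$ be a prime power and let $f\in\mathbb{F}_q[T][X]$ be irreducible with $\deg_X f\ge1$. Then for all sufficiently large $n$ and every monic prime $P$ of $\mathbb{F}_q[T]$, $$\beta_P(n)\le c_f\,\alpha_P(n),$$ where $\alpha_P(n)=\sum_{Q\in M_n}v_P(f(Q))$ and $\beta_P(n)=\max\{v_P(f(Q)):Q\in M_n\}$.
   Context: $M_n$ is the set of monic polynomials of degree $n$ in $\mathbb{F}_q[T]$ ($n$ large enough that $f(Q)\ne0$ for all $Q\in M_n$); $v_P$ is the $P$-adic valuation. $V_f=\{g\in\mathbb{F}_q[T]: f(X+g)=f(X)\}$ and $c_f=1/|V_f|$. -}

module Defs where

open import Data.Nat as ℕ using (ℕ; zero; suc; _≤_; _⊔_)
open import Data.Nat.Primality using (Prime)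
open import Data.Fin using (Fin)
open import Data.List using (List; []; _∷_; map; _++_; concatMap; foldr; length)
open import Data.List.Relation.Unary.All using (All)
open import Data.List.Relation.Unary.Any using (Any)
open import Data.List.Relation.Unary.AllPairs using (AllPairs)
open import Data.List.Relation.Unary.Unique.Propositional using (Unique)
open import Data.List.Membership.Propositional using (_∈_)
open import Data.Product using (Σ; ∃; ∃-syntax; _×_; _,_)
open import Data.Sum using (_⊎_)
open import Data.Unit using (⊤)
open import Relation.Nullary using (¬_; Dec)
open import Relation.Binary.PropositionalEquality using (_≡_)
open import Algebra.Structures using (IsCommutativeRing)

IsPrimePower : ℕ → Set
IsPrimePower q = ∃[ p ] ∃[ k ] (Prime p × 1 ≤ k × q ≡ p ℕ.^ k)

-- A finite field with exactly q elements (equality is propositional;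
-- every finite field is isomorphic to one of this form).

record FiniteField (q : ℕ) : Set₁ where
  field
    Carrier : Set
    0# 1#   : Carrier
    _+_ _*_ : Carrier → Carrier → Carrier
    -_      : Carrier → Carrier
    isCommutativeRing : IsCommutativeRing _≡_ _+_ _*_ -_ 0# 1#
    0≢1     : ¬ (0# ≡ 1#)
    inverse : ∀ x → ¬ (x ≡ 0#) → ∃[ y ] (x * y ≡ 1#)
    _≟_     : (x y : Carrier) → Dec (x ≡ y)
    elems    : List Carrier
    elems-unique : Unique elems
    elems-complete : ∀ x → x ∈ elems
    elems-length : length elems ≡ q

-- Polynomials over a ring-like carrier A with (setoid) equality _≈_,
-- represented by coefficient lists, lowest degree first.  Trailing
-- zero coefficients are allowed; polynomial equality _≋_ ignores them.

module PolyOver {A : Set} (0# 1# : A) (_+_ _*_ : A → A → A) (-_ : A → A)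
                (_≈_ : A → A → Set) where

  Pol : Set
  Pol = List A

  0ₚ : Pol
  0ₚ = []

  1ₚ : Pol
  1ₚ = 1# ∷ []

  const : A → Pol
  const a = a ∷ []

  infixl 6 _⊕_
  infixl 7 _⊗_
  infix 4 _≋_ _∣_

  _⊕_ : Pol → Pol → Pol
  [] ⊕ q = q
  (a ∷ p) ⊕ [] = a ∷ p
  (a ∷ p) ⊕ (b ∷ q) = (a + b) ∷ (p ⊕ q)

  scale : A → Pol → Pol
  scale a p = map (a *_) p

  _⊗_ : Pol → Pol → Pol
  [] ⊗ q = []
  (a ∷ p) ⊗ q = scale a q ⊕ (0# ∷ (p ⊗ q))

  _^ₚ_ : Pol → ℕ → Pol
  p ^ₚ zero = 1ₚ
  p ^ₚ suc k = p ⊗ (p ^ₚ k)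

  _≋_ : Pol → Pol → Set
  [] ≋ [] = ⊤
  [] ≋ (b ∷ q) = (b ≈ 0#) × ([] ≋ q)
  (a ∷ p) ≋ [] = (a ≈ 0#) × (p ≋ [])
  (a ∷ p) ≋ (b ∷ q) = (a ≈ b) × (p ≋ q)

  coeff : Pol → ℕ → A
  coeff [] i = 0#
  coeff (a ∷ p) zero = a
  coeff (a ∷ p) (suc i) = coeff p i

  Unit : Pol → Set
  Unit p = ∃[ u ] (p ⊗ u ≋ 1ₚ)

  _∣_ : Pol → Pol → Set
  a ∣ b = ∃[ c ] (a ⊗ c ≋ b)

  Irreducible : Pol → Set
  Irreducible p = ¬ (p ≋ 0ₚ) × ¬ Unit p
                × (∀ a b → a ⊗ b ≋ p → Unit a ⊎ Unit b)

  evalWith : {B : Set} → B → (B → B → B) → (B → B → B)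
           → (A → B) → Pol → B → B
  evalWith 0B _+B_ _*B_ c [] x = 0B
  evalWith 0B _+B_ _*B_ c (a ∷ p) x = c a +B (x *B evalWith 0B _+B_ _*B_ c p x)

module Setup {q : ℕ} (K : FiniteField q) where
  open FiniteField K public using (Carrier; elems)
  open FiniteField K using (0#; 1#; _+_; _*_; -_)

  negₚ : List Carrier → List Carrier
  negₚ = map -_

  module FT = PolyOver 0# 1# _+_ _*_ -_ _≡_
  open FT public using ()
    renaming (Pol to PolT; _⊕_ to _+T_; _⊗_ to _*T_; _≋_ to _≈T_;
              _^ₚ_ to _^T_; _∣_ to _∣T_; 1ₚ to 1T; 0ₚ to 0T)

  module FTX = PolyOver FT.0ₚ FT.1ₚ FT._⊕_ FT._⊗_ negₚ FT._≋_
  open FTX public using ()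
    renaming (Pol to PolTX; _⊕_ to _+X_; _⊗_ to _*X_; _≋_ to _≈X_;
              Irreducible to IrreducibleX; coeff to coeffX)

  DegX≥1 : PolTX → Set
  DegX≥1 f = ∃[ i ] (1 ≤ i × ¬ (coeffX f i ≈T 0T))

  evalAt : PolTX → PolT → PolT
  evalAt f Q = FTX.evalWith 0T _+T_ _*T_ (λ a → a) f Q

  shift : PolTX → PolT → PolTX
  shift f g = FTX.evalWith FTX.0ₚ _+X_ _*X_ FTX.const f (g ∷ 1T ∷ [])

  InV : PolTX → PolT → Set
  InV f g = shift f g ≈X f

  -- L enumerates V_f (up to polynomial equality) without repetition,
  -- so |V_f| = length L
  EnumeratesV : PolTX → List PolT → Set
  EnumeratesV f L = All (InV f) L
                  × AllPairs (λ g h → ¬ (g ≈T h)) L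
                  × (∀ g → InV f g → Any (g ≈T_) L)

  Monic : PolT → Set
  Monic P = ∃[ cs ] (P ≈T (cs ++ (1# ∷ [])))

  MonicPrime : PolT → Set
  MonicPrime P = Monic P × FT.Irreducible P

  IsVal : PolT → PolT → ℕ → Set
  IsVal P h k = ((P ^T k) ∣T h) × ¬ ((P ^T suc k) ∣T h)

  vecs : ℕ → List (List Carrier)
  vecs zero = [] ∷ []
  vecs (suc n) = concatMap (λ a → map (a ∷_) (vecs n)) elems

  M : ℕ → List PolT
  M n = map (λ cs → cs ++ (1# ∷ [])) (vecs n)

  sumL : List ℕ → ℕ
  sumL = foldr ℕ._+_ 0

  maxL : List ℕ → ℕ
  maxL = foldr _⊔_ 0

  -- α_P(n) and β_P(n), given the valuation function v Q = v_P(f(Q))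
  α : ℕ → (PolT → ℕ) → ℕ
  α n v = sumL (map v (M n))

  β : ℕ → (PolT → ℕ) → ℕ
  β n v = maxL (map v (M n))

-- For g ∈ V_f we have f(Q + g) = f(Q), so translating Q ∈ Mₙ by elements of V_f does
-- not change v_P(f(Q)). Evaluating f(X + g) = f(X) at X = 0 gives f(g) = f(0); if deg g
-- were at least the T-degrees of all coefficients of f, then, as deg_X f ≥ 1, the leading
-- term of f(g) could not cancel and deg f(g) > deg f(0). So deg g is bounded by f alone,
-- and for n beyond that bound g ↦ Q + g embeds V_f into Mₙ. The |V_f| distinct terms
-- v_P(f(Q + g)) = v_P(f(Q)) of α_P(n) then give |V_f| · v_P(f(Q)) ≤ α_P(n) for every
-- Q ∈ Mₙ, in particular for the maximiser.

module Submission where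

open import Defs
open import Level using (0ℓ)
open import Data.Nat as ℕ using (ℕ; zero; suc; _≤_; z≤n; s≤s)
import Data.Nat.Properties as ℕ
open import Data.List using (List; []; _∷_; map; _++_; length; foldr)
open import Data.Product using (∃; ∃-syntax; _×_; _,_; proj₁; proj₂)
open import Data.Sum using (_⊎_; inj₁; inj₂)
open import Data.Unit using (tt)
open import Data.Nat.ListAction using (sum)
open import Data.List.Properties using (foldr-preservesᵇ; length-map)
open import Data.List.Membership.Propositional using (_∈_; _─_)
open import Data.List.Relation.Unary.Any as Any using (here; there)
open import Data.List.Membership.Propositional.Properties using (∈-map⁺; ∈-map⁻; ∈-concatMap⁺; ∈-concatMap⁻)
open import Data.List.Relation.Unary.All as All using (All; []; _∷_)
import Data.List.Relation.Unary.All.Properties as AllProps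
open import Data.List.Relation.Unary.AllPairs using (AllPairs; []; _∷_)
open import Data.Empty using (⊥-elim)
open import Relation.Nullary using (¬_; yes; no)
open import Relation.Binary using (Setoid; IsEquivalence; DecidableEquality)
open import Relation.Binary.PropositionalEquality
  using (_≡_; _≢_; refl; sym; trans; cong; cong₂; module ≡-Reasoning)
open import Algebra.Structures using (IsCommutativeSemiring; IsCommutativeRing)
open import Algebra.Bundles using (CommutativeMonoid; CommutativeSemiring)
import Algebra.Properties.CommutativeSemigroup as CommutativeSemigroupProperties
import Relation.Binary.Reasoning.Setoid as SetoidReasoning
import Algebra.Properties.Group as GroupProperties
open import Algebra.Structures.Biased using (isCommutativeSemiringˡ; isCommutativeMonoidˡ)

module Polynomials {A : Set} {0# 1# : A} {_+_ _*_ : A → A → A} (-_ : A → A)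
                   (isCommutativeSemiring : IsCommutativeSemiring _≡_ _+_ _*_ 0# 1#) where

  open IsCommutativeSemiring isCommutativeSemiring
    using (+-assoc; +-comm; +-identityˡ; +-identityʳ; *-assoc; *-comm; *-identityˡ;
           distribˡ; distribʳ; zeroˡ; zeroʳ)
  open PolyOver 0# 1# _+_ _*_ -_ _≡_ public

  -- A record rather than a function type, so that p and r can be inferred from a proof.
  infix 4 _≐_
  record _≐_ (p r : Pol) : Set where
    constructor coeffwise
    field coeff-≡ : ∀ k → coeff p k ≡ coeff r k
  open _≐_ public

  ≐-isEquivalence : IsEquivalence _≐_
  ≐-isEquivalence = record
    { refl  = coeffwise λ k → refl
    ; sym   = λ e → coeffwise λ k → sym (coeff-≡ e k)
    ; trans = λ e e′ → coeffwise λ k → trans (coeff-≡ e k) (coeff-≡ e′ k)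
    }

  ≐-setoid : Setoid 0ℓ 0ℓ
  ≐-setoid = record { isEquivalence = ≐-isEquivalence }

  open IsEquivalence ≐-isEquivalence public
    using () renaming (refl to ≐-refl; sym to ≐-sym; trans to ≐-trans)

  ≋⇒≐ : ∀ {p r} → p ≋ r → p ≐ r
  ≋⇒≐ {p} {r} e = coeffwise (go p r e)
    where
    go : ∀ p r → p ≋ r → ∀ k → coeff p k ≡ coeff r k
    go []      []      _        _       = refl
    go []      (b ∷ r) (e , es) zero    = sym e
    go []      (b ∷ r) (e , es) (suc k) = go [] r es k
    go (a ∷ p) []      (e , es) zero    = e
    go (a ∷ p) []      (e , es) (suc k) = go p [] es k
    go (a ∷ p) (b ∷ r) (e , es) zero    = e
    go (a ∷ p) (b ∷ r) (e , es) (suc k) = go p r es k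

  ≐⇒≋ : ∀ {p r} → p ≐ r → p ≋ r
  ≐⇒≋ {p} {r} e = go p r (coeff-≡ e)
    where
    go : ∀ p r → (∀ k → coeff p k ≡ coeff r k) → p ≋ r
    go []      []      e = tt
    go []      (b ∷ r) e = sym (e zero) , go [] r (λ k → e (suc k))
    go (a ∷ p) []      e = e zero , go p [] (λ k → e (suc k))
    go (a ∷ p) (b ∷ r) e = e zero , go p r (λ k → e (suc k))

  coeff-⊕ : ∀ p r k → coeff (p ⊕ r) k ≡ coeff p k + coeff r k
  coeff-⊕ []      r       k       = sym (+-identityˡ _)
  coeff-⊕ (a ∷ p) []      k       = sym (+-identityʳ _)
  coeff-⊕ (a ∷ p) (b ∷ r) zero    = refl
  coeff-⊕ (a ∷ p) (b ∷ r) (suc k) = coeff-⊕ p r k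

  coeff-scale : ∀ a p k → coeff (scale a p) k ≡ a * coeff p k
  coeff-scale a []      k       = sym (zeroʳ a)
  coeff-scale a (x ∷ p) zero    = refl
  coeff-scale a (x ∷ p) (suc k) = coeff-scale a p k

  ∷-cong : ∀ {a b p r} → a ≡ b → p ≐ r → a ∷ p ≐ b ∷ r
  ∷-cong a≡b p≐r = coeffwise λ { zero → a≡b ; (suc k) → coeff-≡ p≐r k }

  module _ where
    open ≡-Reasoning

    ⊕-cong : ∀ {p p′ r r′} → p ≐ p′ → r ≐ r′ → p ⊕ r ≐ p′ ⊕ r′
    ⊕-cong {p} {p′} {r} {r′} e e′ = coeffwise λ k → begin
      coeff (p ⊕ r) k         ≡⟨ coeff-⊕ p r k ⟩
      coeff p k + coeff r k   ≡⟨ cong₂ _+_ (coeff-≡ e k) (coeff-≡ e′ k) ⟩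
      coeff p′ k + coeff r′ k ≡⟨ coeff-⊕ p′ r′ k ⟨
      coeff (p′ ⊕ r′) k       ∎

    ⊕-comm : ∀ p r → p ⊕ r ≐ r ⊕ p
    ⊕-comm p r = coeffwise λ k → begin
      coeff (p ⊕ r) k       ≡⟨ coeff-⊕ p r k ⟩
      coeff p k + coeff r k ≡⟨ +-comm _ _ ⟩
      coeff r k + coeff p k ≡⟨ coeff-⊕ r p k ⟨
      coeff (r ⊕ p) k       ∎

    ⊕-assoc : ∀ p r s → (p ⊕ r) ⊕ s ≐ p ⊕ (r ⊕ s)
    ⊕-assoc p r s = coeffwise λ k → begin
      coeff ((p ⊕ r) ⊕ s) k                 ≡⟨ coeff-⊕ (p ⊕ r) s k ⟩
      coeff (p ⊕ r) k + coeff s k           ≡⟨ cong (_+ coeff s k) (coeff-⊕ p r k) ⟩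
      (coeff p k + coeff r k) + coeff s k   ≡⟨ +-assoc _ _ _ ⟩
      coeff p k + (coeff r k + coeff s k)   ≡⟨ cong (coeff p k +_) (coeff-⊕ r s k) ⟨
      coeff p k + coeff (r ⊕ s) k           ≡⟨ coeff-⊕ p (r ⊕ s) k ⟨
      coeff (p ⊕ (r ⊕ s)) k                 ∎

    ⊕-identityʳ : ∀ p → p ⊕ 0ₚ ≐ p
    ⊕-identityʳ p = coeffwise λ k → trans (coeff-⊕ p [] k) (+-identityʳ _)

    scale-cong : ∀ a {p r} → p ≐ r → scale a p ≐ scale a r
    scale-cong a {p} {r} e = coeffwise λ k → begin
      coeff (scale a p) k ≡⟨ coeff-scale a p k ⟩
      a * coeff p k       ≡⟨ cong (a *_) (coeff-≡ e k) ⟩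
      a * coeff r k       ≡⟨ coeff-scale a r k ⟨
      coeff (scale a r) k ∎

    scale-zero : ∀ p → scale 0# p ≐ 0ₚ
    scale-zero p = coeffwise λ k → trans (coeff-scale 0# p k) (zeroˡ _)

    scale-distrib-⊕ : ∀ a p r → scale a (p ⊕ r) ≐ scale a p ⊕ scale a r
    scale-distrib-⊕ a p r = coeffwise λ k → begin
      coeff (scale a (p ⊕ r)) k                   ≡⟨ coeff-scale a (p ⊕ r) k ⟩
      a * coeff (p ⊕ r) k                         ≡⟨ cong (a *_) (coeff-⊕ p r k) ⟩
      a * (coeff p k + coeff r k)                 ≡⟨ distribˡ a _ _ ⟩
      (a * coeff p k) + (a * coeff r k)           ≡⟨ cong₂ _+_ (coeff-scale a p k) (coeff-scale a r k) ⟨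
      coeff (scale a p) k + coeff (scale a r) k   ≡⟨ coeff-⊕ (scale a p) (scale a r) k ⟨
      coeff (scale a p ⊕ scale a r) k             ∎

    scale-distrib-+ : ∀ a b p → scale (a + b) p ≐ scale a p ⊕ scale b p
    scale-distrib-+ a b p = coeffwise λ k → begin
      coeff (scale (a + b) p) k                   ≡⟨ coeff-scale (a + b) p k ⟩
      (a + b) * coeff p k                         ≡⟨ distribʳ _ a b ⟩
      (a * coeff p k) + (b * coeff p k)           ≡⟨ cong₂ _+_ (coeff-scale a p k) (coeff-scale b p k) ⟨
      coeff (scale a p) k + coeff (scale b p) k   ≡⟨ coeff-⊕ (scale a p) (scale b p) k ⟨
      coeff (scale a p ⊕ scale b p) k             ∎

    scale-scale : ∀ a b p → scale a (scale b p) ≐ scale (a * b) p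
    scale-scale a b p = coeffwise λ k → begin
      coeff (scale a (scale b p)) k ≡⟨ coeff-scale a (scale b p) k ⟩
      a * coeff (scale b p) k       ≡⟨ cong (a *_) (coeff-scale b p k) ⟩
      a * (b * coeff p k)           ≡⟨ *-assoc a b _ ⟨
      (a * b) * coeff p k           ≡⟨ coeff-scale (a * b) p k ⟨
      coeff (scale (a * b) p) k     ∎

    scale-identity : ∀ p → scale 1# p ≐ p
    scale-identity p = coeffwise λ k → trans (coeff-scale 1# p k) (*-identityˡ _)

  ∷-zero : ∀ {p} → p ≐ 0ₚ → 0# ∷ p ≐ 0ₚ
  ∷-zero p≐0 = coeffwise λ { zero → refl ; (suc k) → coeff-≡ p≐0 k }

  ⊕-commutativeMonoid : CommutativeMonoid 0ℓ 0ℓ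
  ⊕-commutativeMonoid = record
    { _≈_ = _≐_ ; _∙_ = _⊕_ ; ε = 0ₚ
    ; isCommutativeMonoid = isCommutativeMonoidˡ record
      { isSemigroup = record
        { isMagma = record { isEquivalence = ≐-isEquivalence ; ∙-cong = ⊕-cong }
        ; assoc   = ⊕-assoc }
      ; identityˡ = λ p → ≐-refl
      ; comm      = ⊕-comm
      }
    }

  open CommutativeSemigroupProperties (CommutativeMonoid.commutativeSemigroup ⊕-commutativeMonoid)
    using () renaming (interchange to ⊕-interchange; x∙yz≈y∙xz to ⊕-leftComm)

  module _ where
    open SetoidReasoning ≐-setoid

    ⊗-congʳ : ∀ p {r r′} → r ≐ r′ → p ⊗ r ≐ p ⊗ r′
    ⊗-congʳ []      r≐r′ = ≐-refl
    ⊗-congʳ (a ∷ p) r≐r′ = ⊕-cong (scale-cong a r≐r′) (∷-cong refl (⊗-congʳ p r≐r′))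

    ⊗-zeroʳ : ∀ p → p ⊗ 0ₚ ≐ 0ₚ
    ⊗-zeroʳ []      = ≐-refl
    ⊗-zeroʳ (a ∷ p) = ∷-zero (⊗-zeroʳ p)

    ⊗-∷ʳ : ∀ r a p → r ⊗ (a ∷ p) ≐ scale a r ⊕ (0# ∷ r ⊗ p)
    ⊗-∷ʳ []      a p = ≐-sym (∷-zero ≐-refl)
    ⊗-∷ʳ (b ∷ r) a p = ∷-cong (cong (_+ 0#) (*-comm b a)) (begin
      scale b p ⊕ r ⊗ (a ∷ p)                     ≈⟨ ⊕-cong ≐-refl (⊗-∷ʳ r a p) ⟩
      scale b p ⊕ (scale a r ⊕ (0# ∷ r ⊗ p))      ≈⟨ ⊕-leftComm (scale b p) (scale a r) _ ⟩
      scale a r ⊕ (scale b p ⊕ (0# ∷ r ⊗ p))      ∎)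

    ⊗-comm : ∀ p r → p ⊗ r ≐ r ⊗ p
    ⊗-comm []      r = ≐-sym (⊗-zeroʳ r)
    ⊗-comm (a ∷ p) r = begin
      scale a r ⊕ (0# ∷ p ⊗ r)  ≈⟨ ⊕-cong ≐-refl (∷-cong refl (⊗-comm p r)) ⟩
      scale a r ⊕ (0# ∷ r ⊗ p)  ≈⟨ ⊗-∷ʳ r a p ⟨
      r ⊗ (a ∷ p)               ∎

    ⊗-congˡ : ∀ {p p′} r → p ≐ p′ → p ⊗ r ≐ p′ ⊗ r
    ⊗-congˡ {p} {p′} r p≐p′ = begin
      p ⊗ r   ≈⟨ ⊗-comm p r ⟩
      r ⊗ p   ≈⟨ ⊗-congʳ r p≐p′ ⟩
      r ⊗ p′  ≈⟨ ⊗-comm r p′ ⟩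
      p′ ⊗ r  ∎

    ⊗-cong : ∀ {p p′ r r′} → p ≐ p′ → r ≐ r′ → p ⊗ r ≐ p′ ⊗ r′
    ⊗-cong {p′ = p′} {r} p≐p′ r≐r′ = ≐-trans (⊗-congˡ r p≐p′) (⊗-congʳ p′ r≐r′)

    0∷-distrib-⊕ : ∀ p r → 0# ∷ (p ⊕ r) ≐ (0# ∷ p) ⊕ (0# ∷ r)
    0∷-distrib-⊕ p r = ∷-cong (sym (+-identityˡ 0#)) ≐-refl

    ⊗-distribʳ : ∀ p r s → (p ⊕ r) ⊗ s ≐ p ⊗ s ⊕ r ⊗ s
    ⊗-distribʳ []      r       s = ≐-refl
    ⊗-distribʳ (a ∷ p) []      s = ≐-sym (⊕-identityʳ _)
    ⊗-distribʳ (a ∷ p) (b ∷ r) s = begin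
      scale (a + b) s ⊕ (0# ∷ (p ⊕ r) ⊗ s)
        ≈⟨ ⊕-cong (scale-distrib-+ a b s) (∷-cong refl (⊗-distribʳ p r s)) ⟩
      (scale a s ⊕ scale b s) ⊕ (0# ∷ (p ⊗ s ⊕ r ⊗ s))
        ≈⟨ ⊕-cong ≐-refl (0∷-distrib-⊕ (p ⊗ s) (r ⊗ s)) ⟩
      (scale a s ⊕ scale b s) ⊕ ((0# ∷ p ⊗ s) ⊕ (0# ∷ r ⊗ s))
        ≈⟨ ⊕-interchange (scale a s) (scale b s) _ _ ⟩
      (a ∷ p) ⊗ s ⊕ (b ∷ r) ⊗ s
        ∎

    scale-⊗ : ∀ a p r → scale a p ⊗ r ≐ scale a (p ⊗ r)
    scale-⊗ a []      r = ≐-refl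
    scale-⊗ a (b ∷ p) r = begin
      scale (a * b) r ⊕ (0# ∷ scale a p ⊗ r)          ≈⟨ ⊕-cong (≐-sym (scale-scale a b r)) (∷-cong refl (scale-⊗ a p r)) ⟩
      scale a (scale b r) ⊕ (0# ∷ scale a (p ⊗ r))    ≈⟨ ⊕-cong ≐-refl (∷-cong (zeroʳ a) ≐-refl) ⟨
      scale a (scale b r) ⊕ scale a (0# ∷ p ⊗ r)      ≈⟨ scale-distrib-⊕ a (scale b r) _ ⟨
      scale a ((b ∷ p) ⊗ r)                           ∎

    0∷-⊗ : ∀ p r → (0# ∷ p) ⊗ r ≐ 0# ∷ p ⊗ r
    0∷-⊗ p r = ⊕-cong (scale-zero r) ≐-refl

    ⊗-assoc : ∀ p r s → (p ⊗ r) ⊗ s ≐ p ⊗ (r ⊗ s)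
    ⊗-assoc []      r s = ≐-refl
    ⊗-assoc (a ∷ p) r s = begin
      (scale a r ⊕ (0# ∷ p ⊗ r)) ⊗ s        ≈⟨ ⊗-distribʳ (scale a r) _ s ⟩
      scale a r ⊗ s ⊕ (0# ∷ p ⊗ r) ⊗ s      ≈⟨ ⊕-cong (scale-⊗ a r s) (0∷-⊗ (p ⊗ r) s) ⟩
      scale a (r ⊗ s) ⊕ (0# ∷ (p ⊗ r) ⊗ s)  ≈⟨ ⊕-cong ≐-refl (∷-cong refl (⊗-assoc p r s)) ⟩
      (a ∷ p) ⊗ (r ⊗ s)                     ∎

    ⊗-identityˡ : ∀ p → 1ₚ ⊗ p ≐ p
    ⊗-identityˡ p = begin
      scale 1# p ⊕ (0# ∷ [])  ≈⟨ ⊕-cong (scale-identity p) (∷-zero ≐-refl) ⟩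
      p ⊕ 0ₚ                  ≈⟨ ⊕-identityʳ p ⟩
      p                       ∎

  ≋-isEquivalence : IsEquivalence _≋_
  ≋-isEquivalence = record
    { refl  = λ {p} → ≐⇒≋ {p} ≐-refl
    ; sym   = λ {p} {r} e → ≐⇒≋ (≐-sym (≋⇒≐ {p} {r} e))
    ; trans = λ {p} {r} {s} e e′ → ≐⇒≋ (≐-trans (≋⇒≐ {p} {r} e) (≋⇒≐ {r} {s} e′))
    }

  ⊕-⊗-isCommutativeSemiring : IsCommutativeSemiring _≋_ _⊕_ _⊗_ 0ₚ 1ₚ
  ⊕-⊗-isCommutativeSemiring = isCommutativeSemiringˡ record
    { +-isCommutativeMonoid = isCommutativeMonoidˡ record
      { isSemigroup = record
        { isMagma = record
          { isEquivalence = ≋-isEquivalence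
          ; ∙-cong = λ {p} {p′} {r} {r′} e e′ → ≐⇒≋ (⊕-cong (≋⇒≐ {p} {p′} e) (≋⇒≐ {r} {r′} e′)) }
        ; assoc = λ p r s → ≐⇒≋ (⊕-assoc p r s) }
      ; identityˡ = λ p → ≐⇒≋ {p} ≐-refl
      ; comm      = λ p r → ≐⇒≋ (⊕-comm p r)
      }
    ; *-isCommutativeMonoid = isCommutativeMonoidˡ record
      { isSemigroup = record
        { isMagma = record
          { isEquivalence = ≋-isEquivalence
          ; ∙-cong = λ {p} {p′} {r} {r′} e e′ → ≐⇒≋ (⊗-cong (≋⇒≐ {p} {p′} e) (≋⇒≐ {r} {r′} e′)) }
        ; assoc = λ p r s → ≐⇒≋ (⊗-assoc p r s) }
      ; identityˡ = λ p → ≐⇒≋ (⊗-identityˡ p)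
      ; comm      = λ p r → ≐⇒≋ (⊗-comm p r)
      }
    ; distribʳ = λ s p r → ≐⇒≋ (⊗-distribʳ p r s)
    ; zeroˡ    = λ p → tt
    }

  module _ where
    open SetoidReasoning ≐-setoid

    ⊗-identityʳ : ∀ p → p ⊗ 1ₚ ≐ p
    ⊗-identityʳ p = ≐-trans (⊗-comm p 1ₚ) (⊗-identityˡ p)

    ∣-respʳ : ∀ {a b b′} → a ∣ b → b ≐ b′ → a ∣ b′
    ∣-respʳ (c , ac≋b) b≐b′ = c , ≐⇒≋ (≐-trans (≋⇒≐ ac≋b) b≐b′)

    ∣-refl : ∀ {a} → a ∣ a
    ∣-refl {a} = 1ₚ , ≐⇒≋ (⊗-identityʳ a)

    ∣-trans : ∀ {a b c} → a ∣ b → b ∣ c → a ∣ c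
    ∣-trans {a} {b} {c} (d , ad≋b) (e , be≋c) = d ⊗ e , ≐⇒≋ (begin
      a ⊗ (d ⊗ e)  ≈⟨ ⊗-assoc a d e ⟨
      (a ⊗ d) ⊗ e  ≈⟨ ⊗-congˡ e (≋⇒≐ ad≋b) ⟩
      b ⊗ e        ≈⟨ ≋⇒≐ be≋c ⟩
      c            ∎)

    ^-∣-^-suc : ∀ p k → p ^ₚ k ∣ p ^ₚ suc k
    ^-∣-^-suc p k = p , ≐⇒≋ (⊗-comm (p ^ₚ k) p)

    ^-∣-^ : ∀ p {m n} → m ≤ n → p ^ₚ m ∣ p ^ₚ n
    ^-∣-^ p {m} m≤n with o , refl ← ℕ.m≤n⇒∃[o]m+o≡n m≤n
      rewrite ℕ.+-comm m o = go o
      where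
      go : ∀ o → p ^ₚ m ∣ p ^ₚ (o ℕ.+ m)
      go zero    = ∣-refl
      go (suc o) = ∣-trans {p ^ₚ m} (go o) (^-∣-^-suc p (o ℕ.+ m))

  ^-∣-∤⇒≤ : ∀ {p h h′ k k′} → h ≐ h′ → p ^ₚ k ∣ h → ¬ (p ^ₚ suc k′ ∣ h′) → k ≤ k′
  ^-∣-∤⇒≤ {p} {k = k} {k′} h≐h′ pᵏ∣h pᵏ′⁺¹∤h′ with k ℕ.≤? k′
  ... | yes k≤k′ = k≤k′
  ... | no  k≰k′ = ⊥-elim (pᵏ′⁺¹∤h′ (∣-trans {p ^ₚ suc k′} (^-∣-^ p (ℕ.≰⇒> k≰k′)) (∣-respʳ {p ^ₚ k} pᵏ∣h h≐h′)))

  DegreeBelow : Pol → ℕ → Set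
  DegreeBelow p n = ∀ k → n ≤ k → coeff p k ≡ 0#

  HasDegree : Pol → ℕ → Set
  HasDegree p d = DegreeBelow p (suc d) × coeff p d ≢ 0#

  degreeBelow-length : ∀ p → DegreeBelow p (length p)
  degreeBelow-length []      k       _         = refl
  degreeBelow-length (a ∷ p) (suc k) (s≤s n≤k) = degreeBelow-length p k n≤k

  degreeBelow-mono : ∀ {p m n} → DegreeBelow p m → m ≤ n → DegreeBelow p n
  degreeBelow-mono p<m m≤n k n≤k = p<m k (ℕ.≤-trans m≤n n≤k)

  degreeBelow-zero : ∀ {p} n → p ≐ 0ₚ → DegreeBelow p n
  degreeBelow-zero n p≐0 k _ = coeff-≡ p≐0 k

  hasDegree-resp : ∀ {p r d} → p ≐ r → HasDegree p d → HasDegree r d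
  hasDegree-resp p≐r (p<d+1 , pᵈ≢0) =
    (λ k d<k → trans (sym (coeff-≡ p≐r k)) (p<d+1 k d<k)) , (λ rᵈ≡0 → pᵈ≢0 (trans (coeff-≡ p≐r _) rᵈ≡0))

  hasDegree-⊕ : ∀ {a s d} → DegreeBelow a d → HasDegree s d → HasDegree (a ⊕ s) d
  hasDegree-⊕ {a} {s} {d} a<d (s<d+1 , sᵈ≢0) =
    (λ k d<k → trans (coeff-⊕ a s k) (trans (cong₂ _+_ (a<d k (ℕ.<⇒≤ d<k)) (s<d+1 k d<k)) (+-identityˡ 0#))) ,
    (λ e → sᵈ≢0 (begin
      coeff s d                ≡⟨ +-identityˡ _ ⟨
      0# + coeff s d           ≡⟨ cong (_+ coeff s d) (a<d d ℕ.≤-refl) ⟨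
      coeff a d + coeff s d    ≡⟨ coeff-⊕ a s d ⟨
      coeff (a ⊕ s) d          ≡⟨ e ⟩
      0#                       ∎))
    where open ≡-Reasoning

  coeff-∷-⊗ : ∀ x p q k → coeff ((x ∷ p) ⊗ q) k ≡ (x * coeff q k) + coeff (0# ∷ p ⊗ q) k
  coeff-∷-⊗ x p q k = trans (coeff-⊕ (scale x q) _ k) (cong (_+ _) (coeff-scale x q k))

  *-degreeBelow : ∀ {q n} x → DegreeBelow q n → ∀ k → n ≤ k → x * coeff q k ≡ 0#
  *-degreeBelow x q<n k n≤k = trans (cong (x *_) (q<n k n≤k)) (zeroʳ x)

  ⊗-degreeBelow : ∀ {p q} a b → DegreeBelow p (suc a) → DegreeBelow q (suc b) →
                  DegreeBelow (p ⊗ q) (suc (a ℕ.+ b)) × coeff (p ⊗ q) (a ℕ.+ b) ≡ coeff p a * coeff q b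
  ⊗-degreeBelow {[]}    a b _ _ = (λ _ _ → refl) , sym (zeroˡ _)
  ⊗-degreeBelow {x ∷ p} {q} zero b p<1 q<b+1 =
    (λ k b<k → trans (coeff-∷-⊗ x p q k) (trans (cong₂ _+_ (x*q[k]≡0 k b<k) (p⊗q-tail k)) (+-identityˡ 0#))) ,
    trans (coeff-∷-⊗ x p q b) (trans (cong (_ +_) (p⊗q-tail b)) (+-identityʳ _))
    where
    x*q[k]≡0 : ∀ k → suc b ≤ k → x * coeff q k ≡ 0#
    x*q[k]≡0 = *-degreeBelow {q} x q<b+1
    p⊗q-tail : ∀ k → coeff (0# ∷ p ⊗ q) k ≡ 0#
    p⊗q-tail = coeff-≡ (∷-zero (⊗-congˡ {p} {[]} q (coeffwise λ k → p<1 (suc k) (s≤s z≤n))))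
  ⊗-degreeBelow {x ∷ p} {q} (suc a) b p<a+2 q<b+1 =
    (λ { (suc k) (s≤s a+b<k) →
          trans (coeff-∷-⊗ x p q (suc k))
                (trans (cong₂ _+_ (x*q[k]≡0 (suc k) (s≤s (ℕ.≤-trans (ℕ.m≤n+m b a) (ℕ.<⇒≤ a+b<k)))) (proj₁ ih k a+b<k))
                       (+-identityˡ 0#)) }) ,
    trans (coeff-∷-⊗ x p q (suc (a ℕ.+ b)))
          (trans (cong₂ _+_ (x*q[k]≡0 (suc (a ℕ.+ b)) (s≤s (ℕ.m≤n+m b a))) (proj₂ ih)) (+-identityˡ _))
    where
    x*q[k]≡0 : ∀ k → suc b ≤ k → x * coeff q k ≡ 0#
    x*q[k]≡0 = *-degreeBelow {q} x q<b+1
    ih : DegreeBelow (p ⊗ q) (suc (a ℕ.+ b)) × coeff (p ⊗ q) (a ℕ.+ b) ≡ coeff p a * coeff q b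
    ih = ⊗-degreeBelow {p} {q} a b (λ k a<k → p<a+2 (suc k) (s≤s a<k)) q<b+1

  module IntegralDomain (_≟_ : DecidableEquality A)
                        (*-nonZero : ∀ {x y} → x ≢ 0# → y ≢ 0# → x * y ≢ 0#) where

    zero-or-hasDegree : ∀ p → p ≐ 0ₚ ⊎ ∃ (HasDegree p)
    zero-or-hasDegree []      = inj₁ ≐-refl
    zero-or-hasDegree (a ∷ p) with zero-or-hasDegree p
    ... | inj₂ (d , p<d+1 , pᵈ≢0) = inj₂ (suc d , (λ { (suc k) (s≤s d<k) → p<d+1 k d<k }) , pᵈ≢0)
    ... | inj₁ p≐0 with a ≟ 0#
    ...   | yes a≡0 = inj₁ (coeffwise λ { zero → a≡0 ; (suc k) → coeff-≡ p≐0 k })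
    ...   | no  a≢0 = inj₂ (0 , (λ { (suc k) _ → coeff-≡ p≐0 k }) , a≢0)

    hasDegree-⊗ : ∀ {p q a b} → HasDegree p a → HasDegree q b → HasDegree (p ⊗ q) (a ℕ.+ b)
    hasDegree-⊗ {p} {q} {a} {b} (p<a+1 , pᵃ≢0) (q<b+1 , qᵇ≢0) with ⊗-degreeBelow {p} {q} a b p<a+1 q<b+1
    ... | pq<a+b+1 , top≡ = pq<a+b+1 , λ top≡0 → *-nonZero pᵃ≢0 qᵇ≢0 (trans (sym top≡) top≡0)

  ⊕-cancelˡ : (∀ x y z → x + y ≡ x + z → y ≡ z) → ∀ p {r s} → p ⊕ r ≐ p ⊕ s → r ≐ s
  ⊕-cancelˡ +-cancelˡ p {r} {s} e = coeffwise λ k → +-cancelˡ (coeff p k) _ _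
    (trans (sym (coeff-⊕ p r k)) (trans (coeff-≡ e k) (coeff-⊕ p s k)))

  lowCoeffs : ℕ → Pol → Pol
  lowCoeffs zero    p       = []
  lowCoeffs (suc n) []      = 0# ∷ lowCoeffs n []
  lowCoeffs (suc n) (x ∷ p) = x ∷ lowCoeffs n p

  -- (cs ++ 1ₚ) ⊕ g written as a list of the same length as cs ++ 1ₚ, which is how Mₙ
  -- lists its elements; it is that sum when deg g < length cs (monicAdd-≐).
  monicAdd : Pol → Pol → Pol
  monicAdd cs g = (cs ⊕ lowCoeffs (length cs) g) ++ 1ₚ

  length-⊕-lowCoeffs : ∀ cs g → length (cs ⊕ lowCoeffs (length cs) g) ≡ length cs
  length-⊕-lowCoeffs []       g       = refl
  length-⊕-lowCoeffs (c ∷ cs) []      = cong suc (length-⊕-lowCoeffs cs [])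
  length-⊕-lowCoeffs (c ∷ cs) (x ∷ g) = cong suc (length-⊕-lowCoeffs cs g)

  monicAdd-≐ : ∀ cs g → DegreeBelow g (length cs) → monicAdd cs g ≐ (cs ++ 1ₚ) ⊕ g
  monicAdd-≐ []       g       g<0   = coeffwise λ k →
    sym (trans (coeff-⊕ 1ₚ g k) (trans (cong (coeff 1ₚ k +_) (g<0 k z≤n)) (+-identityʳ _)))
  monicAdd-≐ (c ∷ cs) []      _     = ∷-cong (+-identityʳ c)
    (≐-trans (monicAdd-≐ cs [] (λ _ _ → refl)) (⊕-identityʳ (cs ++ 1ₚ)))
  monicAdd-≐ (c ∷ cs) (x ∷ g) g<n+1 = ∷-cong refl
    (monicAdd-≐ cs g (λ k n≤k → g<n+1 (suc k) (s≤s n≤k)))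

module HornerEvaluation (R : CommutativeSemiring 0ℓ 0ℓ) (-_ : CommutativeSemiring.Carrier R → CommutativeSemiring.Carrier R) where

  open CommutativeSemiring R renaming (refl to ≈-refl; sym to ≈-sym; trans to ≈-trans)

  open PolyOver 0# 1# _+_ _*_ -_ _≈_
  open SetoidReasoning setoid
  open CommutativeSemigroupProperties +-commutativeSemigroup
    using () renaming (interchange to +-interchange)
  open CommutativeSemigroupProperties *-commutativeSemigroup
    using () renaming (x∙yz≈y∙xz to *-leftComm)

  eval : Pol → Carrier → Carrier
  eval p x = evalWith 0# _+_ _*_ (λ a → a) p x

  translate : Pol → Carrier → Pol
  translate f g = evalWith 0ₚ _⊕_ _⊗_ const f (g ∷ 1# ∷ [])

  eval-⊕ : ∀ p r x → eval (p ⊕ r) x ≈ eval p x + eval r x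
  eval-⊕ []      r       x = ≈-sym (+-identityˡ _)
  eval-⊕ (a ∷ p) []      x = ≈-sym (+-identityʳ _)
  eval-⊕ (a ∷ p) (b ∷ r) x = begin
    (a + b) + x * eval (p ⊕ r) x                ≈⟨ +-congˡ (*-congˡ (eval-⊕ p r x)) ⟩
    (a + b) + x * (eval p x + eval r x)         ≈⟨ +-congˡ (distribˡ x _ _) ⟩
    (a + b) + (x * eval p x + x * eval r x)     ≈⟨ +-interchange a b _ _ ⟩
    (a + x * eval p x) + (b + x * eval r x)     ∎

  eval-scale : ∀ a p x → eval (scale a p) x ≈ a * eval p x
  eval-scale a []      x = ≈-sym (zeroʳ a)
  eval-scale a (b ∷ p) x = begin
    a * b + x * eval (scale a p) x     ≈⟨ +-congˡ (*-congˡ (eval-scale a p x)) ⟩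
    a * b + x * (a * eval p x)         ≈⟨ +-congˡ (*-leftComm x a _) ⟩
    a * b + a * (x * eval p x)         ≈⟨ distribˡ a b _ ⟨
    a * (b + x * eval p x)             ∎

  eval-⊗ : ∀ p r x → eval (p ⊗ r) x ≈ eval p x * eval r x
  eval-⊗ []      r x = ≈-sym (zeroˡ _)
  eval-⊗ (a ∷ p) r x = begin
    eval (scale a r ⊕ (0# ∷ p ⊗ r)) x                ≈⟨ eval-⊕ (scale a r) _ x ⟩
    eval (scale a r) x + (0# + x * eval (p ⊗ r) x)   ≈⟨ +-cong (eval-scale a r x) (+-identityˡ _) ⟩
    a * eval r x + x * eval (p ⊗ r) x                ≈⟨ +-congˡ (*-congˡ (eval-⊗ p r x)) ⟩
    a * eval r x + x * (eval p x * eval r x)         ≈⟨ +-congˡ (*-assoc x _ _) ⟨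
    a * eval r x + (x * eval p x) * eval r x         ≈⟨ distribʳ (eval r x) a _ ⟨
    (a + x * eval p x) * eval r x                    ∎

  eval-zero : ∀ p x → p ≋ 0ₚ → eval p x ≈ 0#
  eval-zero []      x _          = ≈-refl
  eval-zero (a ∷ p) x (a≈0 , p≋0) = begin
    a + x * eval p x   ≈⟨ +-cong a≈0 (*-congˡ (eval-zero p x p≋0)) ⟩
    0# + x * 0#        ≈⟨ +-identityˡ _ ⟩
    x * 0#             ≈⟨ zeroʳ x ⟩
    0#                 ∎

  eval-cong : ∀ {p r} x → p ≋ r → eval p x ≈ eval r x
  eval-cong {[]}    {[]}    x _          = ≈-refl
  eval-cong {[]}    {b ∷ r} x 0≋br       = ≈-sym (eval-zero (b ∷ r) x (≋-sym0 (b ∷ r) 0≋br))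
    where
    ≋-sym0 : ∀ p → 0ₚ ≋ p → p ≋ 0ₚ
    ≋-sym0 []      _          = tt
    ≋-sym0 (b ∷ p) (b≈0 , e)  = b≈0 , ≋-sym0 p e
  eval-cong {a ∷ p} {[]}    x ap≋0       = eval-zero (a ∷ p) x ap≋0
  eval-cong {a ∷ p} {b ∷ r} x (a≈b , p≋r) = +-cong a≈b (*-congˡ (eval-cong x p≋r))

  eval-congʳ : ∀ p {x y} → x ≈ y → eval p x ≈ eval p y
  eval-congʳ []      x≈y = ≈-refl
  eval-congʳ (a ∷ p) x≈y = +-congˡ (*-cong x≈y (eval-congʳ p x≈y))

  eval-translate : ∀ f g x → eval (translate f g) x ≈ eval f (x + g)
  eval-translate []      g x = ≈-refl
  eval-translate (a ∷ f) g x = begin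
    eval (const a ⊕ (g ∷ 1# ∷ []) ⊗ translate f g) x            ≈⟨ eval-⊕ (const a) ((g ∷ 1# ∷ []) ⊗ translate f g) x ⟩
    eval (const a) x + eval ((g ∷ 1# ∷ []) ⊗ translate f g) x   ≈⟨ +-cong (eval-zero-tail a) (eval-⊗ (g ∷ 1# ∷ []) (translate f g) x) ⟩
    a + eval (g ∷ 1# ∷ []) x * eval (translate f g) x           ≈⟨ +-congˡ (*-cong x+g (eval-translate f g x)) ⟩
    a + (x + g) * eval f (x + g)                                ∎
    where
    eval-zero-tail : ∀ a → a + x * 0# ≈ a
    eval-zero-tail a = ≈-trans (+-congˡ (zeroʳ x)) (+-identityʳ a)
    x+g : eval (g ∷ 1# ∷ []) x ≈ x + g
    x+g = begin
      g + x * (1# + x * 0#)  ≈⟨ +-congˡ (*-congˡ (eval-zero-tail 1#)) ⟩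
      g + x * 1#             ≈⟨ +-congˡ (*-identityʳ x) ⟩
      g + x                  ≈⟨ +-comm g x ⟩
      x + g                  ∎

  translate-invariant : ∀ {f g} → translate f g ≋ f → ∀ x → eval f (x + g) ≈ eval f x
  translate-invariant {f} {g} f[X+g]≋f x = ≈-trans (≈-sym (eval-translate f g x)) (eval-cong x f[X+g]≋f)

  coeff-≋0ₚ : ∀ {p} → p ≋ 0ₚ → ∀ i → coeff p i ≈ 0#
  coeff-≋0ₚ {[]}    _            i       = ≈-refl
  coeff-≋0ₚ {a ∷ p} (a≈0 , p≋0) zero    = a≈0
  coeff-≋0ₚ {a ∷ p} (a≈0 , p≋0) (suc i) = coeff-≋0ₚ p≋0 i

  eval-0# : ∀ a p → eval (a ∷ p) 0# ≈ a
  eval-0# a p = ≈-trans (+-congˡ (zeroˡ _)) (+-identityʳ a)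

module _ {A : Set} where

  open CommutativeSemigroupProperties ℕ.+-commutativeSemigroup using () renaming (x∙yz≈y∙xz to +-leftComm)

  sum-─ : ∀ (v : A → ℕ) {x} ys (x∈ys : x ∈ ys) → sum (map v ys) ≡ v x ℕ.+ sum (map v (ys ─ x∈ys))
  sum-─ v     (y ∷ ys) (here refl)  = refl
  sum-─ v {x} (y ∷ ys) (there x∈ys) = trans (cong (v y ℕ.+_) (sum-─ v ys x∈ys)) (+-leftComm (v y) (v x) (sum (map v (ys ─ x∈ys))))

  ∈-─⁺ : ∀ {x y : A} ys (x∈ys : x ∈ ys) → y ∈ ys → x ≢ y → y ∈ ys ─ x∈ys
  ∈-─⁺ (z ∷ ys) (here refl)  (here refl)  x≢y = ⊥-elim (x≢y refl)
  ∈-─⁺ (z ∷ ys) (here refl)  (there y∈ys) x≢y = y∈ys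
  ∈-─⁺ (z ∷ ys) (there x∈ys) (here refl)  x≢y = here refl
  ∈-─⁺ (z ∷ ys) (there x∈ys) (there y∈ys) x≢y = there (∈-─⁺ ys x∈ys y∈ys x≢y)

  sum-mono-⊆ : ∀ (v : A → ℕ) {xs ys} → AllPairs _≢_ xs → All (_∈ ys) xs →
               sum (map v xs) ≤ sum (map v ys)
  sum-mono-⊆ v {[]}     _               _             = z≤n
  sum-mono-⊆ v {x ∷ xs} {ys} (x≢xs ∷ xs!) (x∈ys ∷ xs⊆ys) = begin
    v x ℕ.+ sum (map v xs)              ≤⟨ ℕ.+-monoʳ-≤ (v x) (sum-mono-⊆ v xs! xs⊆ys─x) ⟩
    v x ℕ.+ sum (map v (ys ─ x∈ys))     ≡⟨ sum-─ v ys x∈ys ⟨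
    sum (map v ys)                      ∎
    where
    open ℕ.≤-Reasoning
    xs⊆ys─x : All (_∈ ys ─ x∈ys) xs
    xs⊆ys─x = All.zipWith (λ (x≢z , z∈ys) → ∈-─⁺ ys x∈ys z∈ys x≢z) (x≢xs , xs⊆ys)

  length*≤sum : ∀ (v : A → ℕ) {c xs} → All (λ x → c ≤ v x) xs → length xs ℕ.* c ≤ sum (map v xs)
  length*≤sum v []             = z≤n
  length*≤sum v (c≤vx ∷ c≤vxs) = ℕ.+-mono-≤ c≤vx (length*≤sum v c≤vxs)

  AllPairs-map⁺-restricted : ∀ {P : A → Set} {R S : A → A → Set} {f : A → A} {xs} →
    (∀ {x y} → P x → P y → R x y → S (f x) (f y)) → All P xs → AllPairs R xs → AllPairs S (map f xs)
  AllPairs-map⁺-restricted F []         []         = []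
  AllPairs-map⁺-restricted F (px ∷ pxs) (rx ∷ rxs) =
    AllProps.map⁺ (All.zipWith (λ (py , r) → F px py r) (pxs , rx)) ∷ AllPairs-map⁺-restricted F pxs rxs

*-maxL-≤ : ∀ m b {xs} → All (λ x → m ℕ.* x ≤ b) xs → m ℕ.* foldr ℕ._⊔_ 0 xs ≤ b
*-maxL-≤ m b = foldr-preservesᵇ (λ {x} {y} mx≤b my≤b → ℕ.≤-trans (ℕ.≤-reflexive (ℕ.*-distribˡ-⊔ m x y)) (ℕ.⊔-lub mx≤b my≤b))
  (ℕ.≤-trans (ℕ.≤-reflexive (ℕ.*-zeroʳ m)) z≤n)

module OverFiniteField {q : ℕ} (K : FiniteField q) where

  open FiniteField K hiding (Carrier; elems)
  open Setup K
  private module K = IsCommutativeRing isCommutativeRing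

  +-cancelˡ : ∀ x y z → x + y ≡ x + z → y ≡ z
  +-cancelˡ = GroupProperties.∙-cancelˡ (record { isGroup = K.+-isGroup })

  *-nonZero : ∀ {x y} → x ≢ 0# → y ≢ 0# → x * y ≢ 0#
  *-nonZero {x} {y} x≢0 y≢0 xy≡0 with x⁻¹ , xx⁻¹≡1 ← inverse x x≢0 = y≢0 (begin
    y              ≡⟨ K.*-identityˡ y ⟨
    1# * y         ≡⟨ cong (_* y) xx⁻¹≡1 ⟨
    (x * x⁻¹) * y  ≡⟨ cong (_* y) (K.*-comm x x⁻¹) ⟩
    (x⁻¹ * x) * y  ≡⟨ K.*-assoc x⁻¹ x y ⟩
    x⁻¹ * (x * y)  ≡⟨ cong (x⁻¹ *_) xy≡0 ⟩
    x⁻¹ * 0#       ≡⟨ K.zeroʳ x⁻¹ ⟩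
    0#             ∎)
    where open ≡-Reasoning

  open Polynomials -_ K.isCommutativeSemiring
  open IntegralDomain _≟_ *-nonZero

  K[T] : CommutativeSemiring 0ℓ 0ℓ
  K[T] = record { isCommutativeSemiring = ⊕-⊗-isCommutativeSemiring }

  open HornerEvaluation K[T] negₚ
  private module K[T] = CommutativeSemiring K[T]

  coeffBound : PolTX → ℕ
  coeffBound f = foldr ℕ._⊔_ 0 (map length f)

  coeffs-degreeBelow : ∀ f → All (λ a → DegreeBelow a (coeffBound f)) f
  coeffs-degreeBelow []      = []
  coeffs-degreeBelow (a ∷ f) =
    degreeBelow-mono {a} (degreeBelow-length a) (ℕ.m≤m⊔n (length a) (coeffBound f)) ∷
    All.map (λ {b} b<B → degreeBelow-mono {b} b<B (ℕ.m≤n⊔m (length a) (coeffBound f))) (coeffs-degreeBelow f)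

  -- Once deg g ≥ B, the top term g^k fₖ of f(g) can no longer be cancelled by lower terms.
  eval-zero-or-hasDegree : ∀ {g m B} → HasDegree g m → B ≤ m → ∀ f → All (λ a → DegreeBelow a B) f →
                           f ≈X [] ⊎ ∃ (HasDegree (eval f g))
  eval-zero-or-hasDegree g~m B≤m []      []             = inj₁ tt
  eval-zero-or-hasDegree {g} {m} g~m B≤m (a ∷ f) (a<B ∷ f<B) with eval-zero-or-hasDegree g~m B≤m f f<B
  ... | inj₂ (D , fg~D) =
    inj₂ (m ℕ.+ D , hasDegree-⊕ {a} (degreeBelow-mono {a} a<B (ℕ.≤-trans B≤m (ℕ.m≤m+n m D))) (hasDegree-⊗ {g} g~m fg~D))
  ... | inj₁ f≋0 with zero-or-hasDegree a
  ...   | inj₁ a≐0      = inj₁ (≐⇒≋ a≐0 , f≋0)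
  ...   | inj₂ (d , a~d) = inj₂ (d , hasDegree-resp (≐-sym fg≐a) a~d)
    where
    open SetoidReasoning ≐-setoid
    fg≐a : eval (a ∷ f) g ≐ a
    fg≐a = begin
      a ⊕ g ⊗ eval f g  ≈⟨ ⊕-cong ≐-refl (⊗-congʳ g (≋⇒≐ (eval-zero f g f≋0))) ⟩
      a ⊕ g ⊗ 0ₚ        ≈⟨ ⊕-cong ≐-refl (⊗-zeroʳ g) ⟩
      a ⊕ 0ₚ            ≈⟨ ⊕-identityʳ a ⟩
      a                 ∎

  -- If f(X + g) = f(X) then f(g) = f(0) = f₀, whose degree is below the bound, so deg g is too.
  translation-degreeBelow : ∀ {f g} → DegX≥1 f → InV f g → DegreeBelow g (coeffBound f)
  translation-degreeBelow {[]}     (i , _ , fᵢ≉0) _ = ⊥-elim (fᵢ≉0 tt)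
  translation-degreeBelow {f₀ ∷ f} {g} (i , 1≤i , fᵢ≉0) g∈V with zero-or-hasDegree g
  ... | inj₁ g≐0 = degreeBelow-zero _ g≐0
  ... | inj₂ (m , g~m) with m ℕ.<? coeffBound (f₀ ∷ f)
  ...   | yes m<B = degreeBelow-mono {g} (proj₁ g~m) m<B
  ...   | no  m≮B with eval-zero-or-hasDegree g~m (ℕ.≮⇒≥ m≮B) f (All.tail (coeffs-degreeBelow (f₀ ∷ f)))
  ...     | inj₁ f≋0         = ⊥-elim (fᵢ≉0 (coeffX-tail-zero i 1≤i f≋0))
    where
    coeffX-tail-zero : ∀ i → 1 ≤ i → f ≈X [] → coeffX (f₀ ∷ f) i ≈T []
    coeffX-tail-zero (suc i) _ f≋0 = coeff-≋0ₚ f≋0 i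
  ...     | inj₂ (D , fg~D) = ⊥-elim (proj₂ f₀~m+D (All.head f<B (m ℕ.+ D) m+D≥B))
    where
    f<B : All (λ a → DegreeBelow a (coeffBound (f₀ ∷ f))) (f₀ ∷ f)
    f<B = coeffs-degreeBelow (f₀ ∷ f)
    m+D≥B : coeffBound (f₀ ∷ f) ≤ m ℕ.+ D
    m+D≥B = ℕ.≤-trans (ℕ.≮⇒≥ m≮B) (ℕ.m≤m+n m D)
    f₀⊕g⊗fg~m+D : HasDegree (f₀ ⊕ g ⊗ eval f g) (m ℕ.+ D)
    f₀⊕g⊗fg~m+D = hasDegree-⊕ {f₀} (degreeBelow-mono {f₀} (All.head f<B) m+D≥B) (hasDegree-⊗ {g} g~m fg~D)
    f[g]≐f₀ : eval (f₀ ∷ f) g ≐ f₀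
    f[g]≐f₀ = ≋⇒≐ (K[T].trans (translate-invariant g∈V 0ₚ) (eval-0# f₀ f))
    f₀~m+D : HasDegree f₀ (m ℕ.+ D)
    f₀~m+D = hasDegree-resp f[g]≐f₀ f₀⊕g⊗fg~m+D

  vecs-complete : ∀ {n} cs → length cs ≡ n → cs ∈ vecs n
  vecs-complete []       refl = here refl
  vecs-complete (c ∷ cs) refl = ∈-concatMap⁺ (λ a → map (a ∷_) (vecs (length cs)))
    (Any.map (λ { refl → ∈-map⁺ (c ∷_) (vecs-complete cs refl) }) (elems-complete c))

  vecs-length : ∀ n {cs} → cs ∈ vecs n → length cs ≡ n
  vecs-length zero    (here refl) = refl
  vecs-length (suc n) cs∈
    with a , cs∈a∷vecs ← Any.satisfied (∈-concatMap⁻ (λ a → map (a ∷_) (vecs n)) {elems} cs∈)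
    with ds , ds∈ , refl ← ∈-map⁻ (a ∷_) cs∈a∷vecs = cong suc (vecs-length n ds∈)

  module Translates {f} (degX≥1 : DegX≥1 f) {n} (B≤n : coeffBound f ≤ n)
                    (P : PolT) (v : PolT → ℕ) (isVal : ∀ Q → Q ∈ M n → IsVal P (evalAt f Q) (v Q))
                    {cs} (cs∈ : cs ∈ vecs n) where

    Q : PolT
    Q = cs ++ 1ₚ

    V-degreeBelow : ∀ {g} → InV f g → DegreeBelow g (length cs)
    V-degreeBelow {g} g∈V = degreeBelow-mono {g} (translation-degreeBelow degX≥1 g∈V)
                                          (ℕ.≤-trans B≤n (ℕ.≤-reflexive (sym (vecs-length n cs∈))))

    monicAdd∈M : ∀ g → monicAdd cs g ∈ M n
    monicAdd∈M g = ∈-map⁺ (_++ 1ₚ) (vecs-complete _ (trans (length-⊕-lowCoeffs cs g) (vecs-length n cs∈)))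

    v-monicAdd : ∀ {g} → InV f g → v Q ≤ v (monicAdd cs g)
    v-monicAdd {g} g∈V = ^-∣-∤⇒≤ fQ≐fQ+g (proj₁ (isVal Q (∈-map⁺ (_++ 1ₚ) cs∈))) (proj₂ (isVal _ (monicAdd∈M g)))
      where
      fQ≐fQ+g : evalAt f Q ≐ evalAt f (monicAdd cs g)
      fQ≐fQ+g = ≋⇒≐ (K[T].sym (K[T].trans (eval-congʳ f (≐⇒≋ (monicAdd-≐ cs g (V-degreeBelow g∈V))))
                                            (translate-invariant g∈V Q)))

    monicAdd-injective : ∀ {g h} → InV f g → InV f h → monicAdd cs g ≡ monicAdd cs h → g ≐ h
    monicAdd-injective {g} {h} g∈V h∈V eq = ⊕-cancelˡ +-cancelˡ Q (begin
      Q ⊕ g           ≈⟨ monicAdd-≐ cs g (V-degreeBelow g∈V) ⟨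
      monicAdd cs g   ≡⟨ eq ⟩
      monicAdd cs h   ≈⟨ monicAdd-≐ cs h (V-degreeBelow h∈V) ⟩
      Q ⊕ h           ∎)
      where open SetoidReasoning ≐-setoid

    length*v[Q]≤α : ∀ L → EnumeratesV f L → length L ℕ.* v Q ≤ α n v
    length*v[Q]≤α L (L⊆V , L! , _) = begin
      length L ℕ.* v Q    ≡⟨ cong (ℕ._* v Q) (length-map (monicAdd cs) L) ⟨
      length xs ℕ.* v Q   ≤⟨ length*≤sum v (AllProps.map⁺ (All.map v-monicAdd L⊆V)) ⟩
      sum (map v xs)      ≤⟨ sum-mono-⊆ v xs! (AllProps.map⁺ (All.map (λ {g} _ → monicAdd∈M g) L⊆V)) ⟩
      α n v               ∎
      where
      open ℕ.≤-Reasoning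
      xs : List PolT
      xs = map (monicAdd cs) L
      xs! : AllPairs _≢_ xs
      xs! = AllPairs-map⁺-restricted (λ g∈V h∈V g≉h eq → g≉h (≐⇒≋ (monicAdd-injective g∈V h∈V eq))) L⊆V L!

  length*v≤α : ∀ {f} → DegX≥1 f → ∀ {n} → coeffBound f ≤ n →
               ∀ P v → (∀ Q → Q ∈ M n → IsVal P (evalAt f Q) (v Q)) →
               ∀ L → EnumeratesV f L → ∀ {Q} → Q ∈ M n → length L ℕ.* v Q ≤ α n v
  length*v≤α degX≥1 B≤n P v isVal L enumV Q∈M with cs , cs∈ , refl ← ∈-map⁻ (_++ 1ₚ) Q∈M =
    Translates.length*v[Q]≤α degX≥1 B≤n P v isVal cs∈ L enumV

open import Data.Nat using (_*_)

lemma3p2 : ∀ {q : ℕ} (K : FiniteField q) → IsPrimePower q →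
    (f : Setup.PolTX K) → Setup.IrreducibleX K f → Setup.DegX≥1 K f →
    ∃[ N ] (∀ n → N ≤ n → ∀ (P : Setup.PolT K) → Setup.MonicPrime K P →
      ∀ (v : Setup.PolT K → ℕ) →
      (∀ Q → Q ∈ Setup.M K n → Setup.IsVal K P (Setup.evalAt K f Q) (v Q)) →
      ∀ (L : List (Setup.PolT K)) → Setup.EnumeratesV K f L →
      length L * Setup.β K n v ≤ Setup.α K n v)
lemma3p2 K _ f _ degX≥1 = coeffBound f , λ n B≤n P _ v isVal L enumV →
  *-maxL-≤ (length L) _ (AllProps.map⁺ (All.tabulate (length*v≤α degX≥1 B≤n P v isVal L enumV)))
  where open OverFiniteField K
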